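{- Let $n\ge 6$ and $\lambda=(\lambda_1,\lambda_2)\vdash n$ with $\lambda_1>\lambda_2>1$. (i) If $\lambda_1>\lambda_2+1$, then $k^\lambda_{(2),(\lambda_1-1,\lambda_2,1)}\ge 1$ and $k^\lambda_{(1,1),(\lambda_1-1,\lambda_2,1)}\ge 1$. (ii) If $\lambda_1=\lambda_2+1$, then $k^\lambda_{(2),(\lambda_1,\lambda_2-1,1)}\ge 1$ and $k^\lambda_{(1,1),(\lambda_1,\lambda_2-1,1)}\ge 1$.
   Context: For partitions $\alpha\subseteq\lambda$, row $i$ of $\lambda/\alpha$ consists of the boxes $(i,j)$ with $\alpha_i<j\le\lambda_i$. A SSYT of shape $\lambda/\alpha$ and type $\nu/\alpha$ (for $\alpha\subseteq\nu$) is a filling of $\lambda/\alpha$ with positive integers, weakly increasing along rows, strictly increasing down columns, with exactly $\nu_i-\alpha_i$ entries equal to $i$ for each $i$ ($\alpha_i=0$ for $i>\ell(\alpha)$). Its reverse reading word reads the entries right to left in each row, rows from top to bottom. A sequence $a_1\cdots a_m$ is an $\alpha$-lattice permutation if in every initial segment and for every $i\ge 1$: (number of $i$'s) $+\alpha_i\ge$ (number of $(i+1)$'s) $+\alpha_{i+1}$. A Kronecker tableau of shape $\lambda/\alpha$ and type $\nu/\alpha$ is such a SSYT whose reverse reading word is an $\alpha$-lattice permutation and such that either $\alpha_1=\alpha_2$, or $\alpha_1>\alpha_2$ and (i) the second row of $\lambda/\alpha$ contains exactly $\alpha_1-\alpha_2$ entries $1$, or (ii) the first row of $\lambda/\alpha$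 contains exactly $\alpha_1-\alpha_2$ entries $2$ (with $\alpha_2=0$ if $\ell(\alpha)=1$). $k^\lambda_{\alpha\nu}$ is the number of Kronecker tableaux of shape $\lambda/\alpha$ and type $\nu/\alpha$. -}

module Defs where

open import Data.Nat using (ℕ; zero; suc; _+_; _∸_; _≤_; _<_; _≤ᵇ_; _<ᵇ_; _≡ᵇ_)
open import Data.Bool using (Bool; true; false; _∧_; _∨_; if_then_else_)
open import Data.List using (List; []; _∷_; map; concatMap; filter; length; upTo; reverse; concat; foldr; take)
open import Data.Product using (_×_; _,_)
open import Relation.Binary.PropositionalEquality using (_≡_)
open import Relation.Nullary.Decidable using (Dec)
open import Data.Bool.Properties using () renaming (_≟_ to _≟ᵇ_)

-- 0-based lookup with default 0 (so α_i = 0 beyond ℓ(α)).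
get : List ℕ → ℕ → ℕ
get []       _       = 0
get (x ∷ xs) zero    = x
get (x ∷ xs) (suc i) = get xs i

getRow : List (List ℕ) → ℕ → List ℕ
getRow []       _       = []
getRow (x ∷ xs) zero    = x
getRow (x ∷ xs) (suc i) = getRow xs i

part : List ℕ → ℕ → ℕ
part p i = get p (i ∸ 1)

range1 : ℕ → List ℕ
range1 n = map suc (upTo n)

allB : {A : Set} → (A → Bool) → List A → Bool
allB f []       = true
allB f (x ∷ xs) = f x ∧ allB f xs

countEq : ℕ → List ℕ → ℕ
countEq i []       = 0
countEq i (x ∷ xs) = if i ≡ᵇ x then suc (countEq i xs) else countEq i xs

isPartition : List ℕ → Bool
isPartition []           = true
isPartition (x ∷ [])     = 1 ≤ᵇ x
isPartition (x ∷ y ∷ xs) = (y ≤ᵇ x) ∧ isPartition (y ∷ xs)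

contained : List ℕ → List ℕ → Bool
contained α lam = allB (λ i → part α i ≤ᵇ part lam i) (range1 (length α + length lam))

-- A filling T of λ/α is a list of rows; row i (0-based index i-1) lists the
-- entries of boxes (i,j), α_i < j ≤ λ_i, from left to right.
-- Entry in box (i,j), i,j ≥ 1:
entry : List ℕ → List (List ℕ) → ℕ → ℕ → ℕ
entry α T i j = get (getRow T (i ∸ 1)) (j ∸ part α i ∸ 1)

inSkew : List ℕ → List ℕ → ℕ → ℕ → Bool
inSkew lam α i j = (part α i <ᵇ j) ∧ (j ≤ᵇ part lam i)

hasShape : List ℕ → List ℕ → List (List ℕ) → Bool
hasShape lam α T =
  (length T ≡ᵇ length lam) ∧
  allB (λ i → length (getRow T (i ∸ 1)) ≡ᵇ (part lam i ∸ part α i)) (range1 (length lam))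

weaklyIncr : List ℕ → Bool
weaklyIncr []           = true
weaklyIncr (x ∷ [])     = true
weaklyIncr (x ∷ y ∷ xs) = (x ≤ᵇ y) ∧ weaklyIncr (y ∷ xs)

rowsWeak : List (List ℕ) → Bool
rowsWeak T = allB weaklyIncr T

colsStrict : List ℕ → List ℕ → List (List ℕ) → Bool
colsStrict lam α T =
  allB (λ i → allB (λ j →
          if inSkew lam α i j ∧ inSkew lam α (suc i) j
          then entry α T i j <ᵇ entry α T (suc i) j
          else true)
        (range1 (part lam 1)))
       (range1 (length lam))

-- all entries are positive integers (in fact ≤ ℓ(ν), forced by the type)
-- and exactly ν_i - α_i entries equal i, for every i ≥ 1.
-- (entries in [1..ℓ(ν)] makes the count condition trivial for i > ℓ(ν).)
hasType : List ℕ → List ℕ → List (List ℕ) → Bool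
hasType ν α T =
  allB (λ x → (1 ≤ᵇ x) ∧ (x ≤ᵇ length ν)) (concat T) ∧
  allB (λ i → countEq i (concat T) ≡ᵇ (part ν i ∸ part α i)) (range1 (length ν))

isSSYT : List ℕ → List ℕ → List ℕ → List (List ℕ) → Bool
isSSYT lam α ν T = hasShape lam α T ∧ rowsWeak T ∧ colsStrict lam α T ∧ hasType ν α T

revReadingWord : List (List ℕ) → List ℕ
revReadingWord T = concat (map reverse T)

prefixes : List ℕ → List (List ℕ)
prefixes w = map (λ m → take m w) (upTo (suc (length w)))

-- α-lattice permutation. The condition is checked for i = 1 .. bound; for larger i
-- both sides are 0 as long as all letters are ≤ bound and bound ≥ ℓ(α).
latticeUpTo : ℕ → List ℕ → List ℕ → Bool
latticeUpTo bound α w =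
  allB (λ u → allB (λ i → (countEq (suc i) u + part α (suc i)) ≤ᵇ (countEq i u + part α i))
                   (range1 bound))
       (prefixes w)

-- every i ≥ 1 is covered: letters ≤ max letter, α_i = 0 beyond ℓ(α)
maxL : List ℕ → ℕ
maxL = foldr (λ x m → if x ≤ᵇ m then m else x) 0

isαLattice : List ℕ → List ℕ → Bool
isαLattice α w = latticeUpTo (maxL w + length α + 1) α w

countInRow : List (List ℕ) → ℕ → ℕ → ℕ
countInRow T i v = countEq v (getRow T (i ∸ 1))

kronCond : List ℕ → List (List ℕ) → Bool
kronCond α T =
  (part α 1 ≡ᵇ part α 2) ∨
  ((part α 2 <ᵇ part α 1) ∧
     ((countInRow T 2 1 ≡ᵇ (part α 1 ∸ part α 2)) ∨
      (countInRow T 1 2 ≡ᵇ (part α 1 ∸ part α 2))))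

isKroneckerTableau : List ℕ → List ℕ → List ℕ → List (List ℕ) → Bool
isKroneckerTableau lam α ν T =
  isSSYT lam α ν T ∧ isαLattice α (revReadingWord T) ∧ kronCond α T

words : ℕ → ℕ → List (List ℕ)
words zero    N = [] ∷ []
words (suc l) N = concatMap (λ x → map (x ∷_) (words l N)) (range1 N)

fillingsRows : List ℕ → ℕ → List (List (List ℕ))
fillingsRows []       N = [] ∷ []
fillingsRows (l ∷ ls) N = concatMap (λ r → map (r ∷_) (fillingsRows ls N)) (words l N)

candidates : List ℕ → List ℕ → ℕ → List (List (List ℕ))
candidates lam α N = fillingsRows (map (λ i → part lam i ∸ part α i) (range1 (length lam))) N

-- k^λ_{αν}: number of Kronecker tableaux of shape λ/α and type ν/α.
-- Every SSYT of type ν/α has entries in [1..ℓ(ν)], so candidates with N = ℓ(ν)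
-- contains each such tableau exactly once.
kron : List ℕ → List ℕ → List ℕ → ℕ
kron lam α ν =
  length (filter (λ T → isKroneckerTableau lam α ν T ≟ᵇ true) (candidates lam α (length ν)))

-- Each of the four coefficients is positive because an explicit Kronecker tableau exists; the
-- tableaux come in families indexed by block lengths. Writing rows as words of constant blocks,
-- they are  1ᵖ22 / 1^q 2ᵇ 3  for α = (2) (q ≤ 2, b ≤ p), and  1ᵖ3 / 2ᵐ  (m ≤ p) resp.
-- 1ᵖ / 2ᵐ3  (m < p) for α = (1,1); part (i) uses q = 1 and the first (1,1) family, part (ii)
-- uses q = 2 and the second. The α-lattice
-- condition only needs checking at block boundaries: inside a block of one letter each lattice
-- inequality has at most one side growing, so it holds throughout once it holds at both ends.

module Submission where

open import Defs
open import Data.Bool using (Bool; true; false; _∧_; _∨_; if_then_else_; T)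
open import Data.Bool.Properties using (T-≡) renaming (_≟_ to _≟ᵇ_)
open import Data.Empty using (⊥; ⊥-elim)
open import Data.List
  using (List; []; _∷_; _∷ʳ_; _++_; map; concat; concatMap; length; replicate; reverse; take; inits; upTo)
open import Data.List.Properties
  using (++-assoc; ++-identityʳ; length-++; length-replicate; map-∘; map-applyUpTo; reverse-++; unfold-reverse; take-[])
open import Data.List.Membership.Propositional using (_∈_)
open import Data.List.Membership.Propositional.Properties
  using (∈-map⁺; ∈-map⁻; ∈-concatMap⁺; ∈-upTo⁺; ∈-upTo⁻; ∈-filter⁺)
open import Data.List.Relation.Unary.All as All using (All; []; _∷_)
open import Data.List.Relation.Unary.All.Properties using (++⁺; replicate⁺; concat⁻; take⁺; map⁻)
open import Data.List.Relation.Unary.Any as Any using (here; there)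
open import Data.Nat
open import Data.Nat.ListAction using (sum)
open import Data.Nat.Properties
open import Data.Product using (_×_; _,_; proj₁; proj₂)
open import Data.Sum using ([_,_]′)
open import Function using (_∘_; id)
open import Function.Bundles using (module Equivalence)
open import Relation.Binary.PropositionalEquality
open import Relation.Nullary using (yes; no)

open Equivalence using (to)

T-∧ˡ : ∀ x {y} → T (x ∧ y) → T x
T-∧ˡ true _ = _

T-∧ʳ : ∀ x {y} → T (x ∧ y) → T y
T-∧ʳ true h = h

T-∧⁺ : ∀ {x y} → T x → T y → T (x ∧ y)
T-∧⁺ {true} _ q = q

T-∨ʳ : ∀ x {y} → T y → T (x ∨ y)
T-∨ʳ true  _ = _
T-∨ʳ false h = h

T-if⁺ : ∀ {c b} → (T c → T b) → T (if c then b else true)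
T-if⁺ {true}  h = h _
T-if⁺ {false} h = _

allB⁺ : ∀ {A : Set} {f : A → Bool} {xs} → All (T ∘ f) xs → T (allB f xs)
allB⁺ []       = _
allB⁺ (p ∷ ps) = T-∧⁺ p (allB⁺ ps)

allB⁻ : ∀ {A : Set} {f : A → Bool} xs → T (allB f xs) → All (T ∘ f) xs
allB⁻ []       _ = []
allB⁻ {f = f} (x ∷ xs) h = T-∧ˡ (f x) h ∷ allB⁻ xs (T-∧ʳ (f x) h)

∈-range1 : ∀ {N x} → T ((1 ≤ᵇ x) ∧ (x ≤ᵇ N)) → x ∈ range1 N
∈-range1 {N} {suc x} h = ∈-map⁺ suc (∈-upTo⁺ (≤ᵇ⇒≤ (suc x) N h))

∈-range1⁻ : ∀ {n x} → x ∈ range1 n → 1 ≤ x × x ≤ n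
∈-range1⁻ x∈ with ∈-map⁻ suc x∈
... | _ , k∈ , refl = s≤s z≤n , ∈-upTo⁻ k∈

range1-suc : ∀ n → range1 (suc n) ≡ 1 ∷ map suc (range1 n)
range1-suc n = cong (λ xs → 1 ∷ map suc xs) (sym (map-applyUpTo id suc n))

∈-words : ∀ {N} w → All (_∈ range1 N) w → w ∈ words (length w) N
∈-words []      []          = here refl
∈-words {N} (x ∷ w) (x∈ ∷ w∈) =
  ∈-concatMap⁺ (λ y → map (y ∷_) (words (length w) N))
    (Any.map (λ { refl → ∈-map⁺ (x ∷_) (∈-words w w∈) }) x∈)

∈-fillingsRows : ∀ {N} F → All (All (_∈ range1 N)) F → F ∈ fillingsRows (map length F) N
∈-fillingsRows []      []          = here refl
∈-fillingsRows {N} (r ∷ F) (r∈ ∷ F∈) =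
  ∈-concatMap⁺ (λ r′ → map (r′ ∷_) (fillingsRows (map length F) N))
    (Any.map (λ { refl → ∈-map⁺ (r ∷_) (∈-fillingsRows F F∈) }) (∈-words r r∈))

rowLengths : ∀ F (g : ℕ → ℕ) → (∀ k → k < length F → length (getRow F k) ≡ g (suc k)) →
             map length F ≡ map g (range1 (length F))
rowLengths []      g _ = refl
rowLengths (r ∷ F) g h = begin
  length r ∷ map length F
    ≡⟨ cong₂ _∷_ (h 0 z<s) (rowLengths F (g ∘ suc) (λ k k< → h (suc k) (s<s k<))) ⟩
  g 1 ∷ map (g ∘ suc) (range1 (length F))
    ≡⟨ cong (g 1 ∷_) (map-∘ (range1 (length F))) ⟩
  map g (1 ∷ map suc (range1 (length F)))
    ≡⟨ cong (map g) (sym (range1-suc (length F))) ⟩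
  map g (range1 (suc (length F)))
    ∎
  where open ≡-Reasoning

∈-candidates : ∀ {lam α N} F → T (hasShape lam α F) → All (All (_∈ range1 N)) F →
               F ∈ candidates lam α N
∈-candidates {lam} {α} {N} F shape F∈ =
  subst (λ ls → F ∈ fillingsRows ls N) rowsShape (∈-fillingsRows F F∈)
  where
  F≡lam : length F ≡ length lam
  F≡lam = ≡ᵇ⇒≡ _ _ (T-∧ˡ (length F ≡ᵇ length lam) shape)
  rowLength : ℕ → ℕ
  rowLength i = part lam i ∸ part α i
  rows : All (T ∘ λ i → length (getRow F (i ∸ 1)) ≡ᵇ rowLength i) (range1 (length lam))
  rows = allB⁻ _ (T-∧ʳ (length F ≡ᵇ length lam) shape)
  rowsShape : map length F ≡ map rowLength (range1 (length lam))
  rowsShape = subst (λ n → map length F ≡ map rowLength (range1 n)) F≡lam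
    (rowLengths F rowLength λ k k< → ≡ᵇ⇒≡ _ _ (All.lookup rows (∈-map⁺ suc (∈-upTo⁺ (subst (k <_) F≡lam k<)))))

kron-pos : ∀ lam α ν F → T (isKroneckerTableau lam α ν F) → 1 ≤ kron lam α ν
kron-pos lam α ν F kt =
  nonEmpty (∈-filter⁺ (λ F → isKroneckerTableau lam α ν F ≟ᵇ true)
                      (∈-candidates {lam} {α} F shape letters) (to T-≡ kt))
  where
  nonEmpty : ∀ {A : Set} {x : A} {xs} → x ∈ xs → 1 ≤ length xs
  nonEmpty (here _)  = s≤s z≤n
  nonEmpty (there _) = s≤s z≤n
  ssyt : T (isSSYT lam α ν F)
  ssyt = T-∧ˡ (isSSYT lam α ν F) kt
  shape : T (hasShape lam α F)
  shape = T-∧ˡ (hasShape lam α F) ssyt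
  type : T (hasType ν α F)
  type = T-∧ʳ (colsStrict lam α F) (T-∧ʳ (rowsWeak F) (T-∧ʳ (hasShape lam α F) ssyt))
  letters : All (All (_∈ range1 (length ν))) F
  letters = concat⁻ (All.map ∈-range1 (allB⁻ _ (T-∧ˡ (allB _ (concat F)) type)))

kron-pos-twoRow : ∀ l₁ l₂ α ν r₁ r₂ →
  length r₁ ≡ l₁ ∸ part α 1 → length r₂ ≡ l₂ ∸ part α 2 →
  T (weaklyIncr r₁) → T (weaklyIncr r₂) →
  (∀ j → part α 1 < j → j ≤ l₂ → get r₁ (j ∸ part α 1 ∸ 1) < get r₂ (j ∸ part α 2 ∸ 1)) →
  T (hasType ν α (r₁ ∷ r₂ ∷ [])) →
  T (isαLattice α (revReadingWord (r₁ ∷ r₂ ∷ []))) →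
  T (kronCond α (r₁ ∷ r₂ ∷ [])) →
  1 ≤ kron (l₁ ∷ l₂ ∷ []) α ν
kron-pos-twoRow l₁ l₂ α ν r₁ r₂ len₁ len₂ incr₁ incr₂ columns type lattice cond =
  kron-pos lam α ν F
    (T-∧⁺ {isSSYT lam α ν F}
          (T-∧⁺ shape (T-∧⁺ (T-∧⁺ incr₁ (T-∧⁺ incr₂ _)) (T-∧⁺ cols type)))
          (T-∧⁺ {isαLattice α (revReadingWord F)} lattice cond))
  where
  lam : List ℕ
  lam = l₁ ∷ l₂ ∷ []
  F : List (List ℕ)
  F = r₁ ∷ r₂ ∷ []
  shape : T (hasShape lam α F)
  shape = T-∧⁺ (≡⇒≡ᵇ _ _ len₁) (T-∧⁺ (≡⇒≡ᵇ _ _ len₂) _)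
  row₁ : ∀ j → T (inSkew lam α 1 j ∧ inSkew lam α 2 j) → T (entry α F 1 j <ᵇ entry α F 2 j)
  row₁ j boxes = <⇒<ᵇ (columns j (<ᵇ⇒< _ _ (T-∧ˡ (part α 1 <ᵇ j) (T-∧ˡ (inSkew lam α 1 j) boxes)))
                                 (≤ᵇ⇒≤ _ _ (T-∧ʳ (part α 2 <ᵇ j) (T-∧ʳ (inSkew lam α 1 j) boxes))))
  noRow₃ : ∀ j → j ∈ range1 l₁ → T (inSkew lam α 2 j ∧ inSkew lam α 3 j) → ⊥
  noRow₃ j j∈ boxes with ∈-range1⁻ j∈
  ... | s≤s {n = k} z≤n , _ = T-∧ʳ (part α 3 <ᵇ suc k) (T-∧ʳ (inSkew lam α 2 (suc k)) boxes)
  cols : T (colsStrict lam α F)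
  cols = T-∧⁺ (allB⁺ {xs = range1 l₁} (All.tabulate λ {j} _ → T-if⁺ (row₁ j)))
              (T-∧⁺ (allB⁺ {xs = range1 l₁} (All.tabulate λ {j} j∈ → T-if⁺ (⊥-elim ∘ noRow₃ j j∈))) _)

blocks : List (ℕ × ℕ) → List ℕ
blocks []             = []
blocks ((k , v) ∷ bs) = replicate k v ++ blocks bs

-- Summed from the right so that, for literal letters, it normalises without trailing `+ 0`.
multiplicity : ℕ → List (ℕ × ℕ) → ℕ
multiplicity x []             = 0
multiplicity x ((k , v) ∷ bs) = if x ≡ᵇ v then multiplicity x bs + k else multiplicity x bs

countEq-++ : ∀ x xs ys → countEq x (xs ++ ys) ≡ countEq x xs + countEq x ys
countEq-++ x []       ys = refl
countEq-++ x (y ∷ xs) ys with x ≡ᵇ y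
... | true  = cong suc (countEq-++ x xs ys)
... | false = countEq-++ x xs ys

countEq-replicate : ∀ x v k → countEq x (replicate k v) ≡ (if x ≡ᵇ v then k else 0)
countEq-replicate x v zero    with x ≡ᵇ v
... | true  = refl
... | false = refl
countEq-replicate x v (suc k) with x ≡ᵇ v in x≡v
... | true  = cong suc (trans (countEq-replicate x v k) (cong (λ b → if b then k else 0) x≡v))
... | false = trans (countEq-replicate x v k) (cong (λ b → if b then k else 0) x≡v)

countEq-replicate-++ : ∀ x v k u → countEq x (replicate k v ++ u) ≡ (if x ≡ᵇ v then k else 0) + countEq x u
countEq-replicate-++ x v k u =
  trans (countEq-++ x (replicate k v) u) (cong (_+ countEq x u) (countEq-replicate x v k))

multiplicity-∷ : ∀ x k v bs → multiplicity x ((k , v) ∷ bs) ≡ (if x ≡ᵇ v then k else 0) + multiplicity x bs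
multiplicity-∷ x k v bs with x ≡ᵇ v
... | true  = +-comm (multiplicity x bs) k
... | false = refl

countEq-blocks : ∀ x bs → countEq x (blocks bs) ≡ multiplicity x bs
countEq-blocks x []             = refl
countEq-blocks x ((k , v) ∷ bs) = begin
  countEq x (replicate k v ++ blocks bs)             ≡⟨ countEq-replicate-++ x v k (blocks bs) ⟩
  (if x ≡ᵇ v then k else 0) + countEq x (blocks bs)  ≡⟨ cong (_ +_) (countEq-blocks x bs) ⟩
  (if x ≡ᵇ v then k else 0) + multiplicity x bs      ≡⟨ sym (multiplicity-∷ x k v bs) ⟩
  multiplicity x ((k , v) ∷ bs)                      ∎
  where open ≡-Reasoning

blocks-++ : ∀ bs cs → blocks (bs ++ cs) ≡ blocks bs ++ blocks cs
blocks-++ []             cs = refl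
blocks-++ ((k , v) ∷ bs) cs = trans (cong (replicate k v ++_) (blocks-++ bs cs)) (sym (++-assoc (replicate k v) _ _))

length-blocks : ∀ bs → length (blocks bs) ≡ sum (map proj₁ bs)
length-blocks []             = refl
length-blocks ((k , v) ∷ bs) = trans (length-++ (replicate k v)) (cong₂ _+_ (length-replicate k) (length-blocks bs))

All-blocks : ∀ {P : ℕ → Set} bs → All (P ∘ proj₂) bs → All P (blocks bs)
All-blocks []             []         = []
All-blocks ((k , v) ∷ bs) (pv ∷ pbs) = ++⁺ (replicate⁺ k pv) (All-blocks bs pbs)

replicate-∷ʳ : ∀ {A : Set} k (a : A) → replicate k a ∷ʳ a ≡ a ∷ replicate k a
replicate-∷ʳ zero    a = refl
replicate-∷ʳ (suc k) a = cong (a ∷_) (replicate-∷ʳ k a)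

reverse-replicate : ∀ {A : Set} k (a : A) → reverse (replicate k a) ≡ replicate k a
reverse-replicate zero    a = refl
reverse-replicate (suc k) a = begin
  reverse (a ∷ replicate k a)     ≡⟨ unfold-reverse a (replicate k a) ⟩
  reverse (replicate k a) ∷ʳ a    ≡⟨ cong (_∷ʳ a) (reverse-replicate k a) ⟩
  replicate k a ∷ʳ a              ≡⟨ replicate-∷ʳ k a ⟩
  a ∷ replicate k a               ∎
  where open ≡-Reasoning

reverse-blocks : ∀ bs → reverse (blocks bs) ≡ blocks (reverse bs)
reverse-blocks []             = refl
reverse-blocks ((k , v) ∷ bs) = begin
  reverse (replicate k v ++ blocks bs)            ≡⟨ reverse-++ (replicate k v) (blocks bs) ⟩
  reverse (blocks bs) ++ reverse (replicate k v)  ≡⟨ cong₂ _++_ (reverse-blocks bs) (reverse-replicate k v) ⟩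
  blocks (reverse bs) ++ replicate k v            ≡⟨ cong (_ ++_) (sym (++-identityʳ (replicate k v))) ⟩
  blocks (reverse bs) ++ blocks ((k , v) ∷ [])    ≡⟨ sym (blocks-++ (reverse bs) _) ⟩
  blocks (reverse bs ++ (k , v) ∷ [])             ≡⟨ cong blocks (sym (unfold-reverse (k , v) bs)) ⟩
  blocks (reverse ((k , v) ∷ bs))                 ∎
  where open ≡-Reasoning

revReadingWord-blocks : ∀ bss → revReadingWord (map blocks bss) ≡ blocks (concatMap reverse bss)
revReadingWord-blocks []         = refl
revReadingWord-blocks (bs ∷ bss) = begin
  reverse (blocks bs) ++ revReadingWord (map blocks bss)
    ≡⟨ cong₂ _++_ (reverse-blocks bs) (revReadingWord-blocks bss) ⟩
  blocks (reverse bs) ++ blocks (concatMap reverse bss)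
    ≡⟨ sym (blocks-++ (reverse bs) _) ⟩
  blocks (concatMap reverse (bs ∷ bss))
    ∎
  where open ≡-Reasoning

concat-blocks : ∀ bss → concat (map blocks bss) ≡ blocks (concat bss)
concat-blocks []         = refl
concat-blocks (bs ∷ bss) = trans (cong (blocks bs ++_) (concat-blocks bss)) (sym (blocks-++ bs (concat bss)))

weaklyIncr-∷ : ∀ {x} w → All (x ≤_) w → T (weaklyIncr w) → T (weaklyIncr (x ∷ w))
weaklyIncr-∷ []      _           _ = _
weaklyIncr-∷ (y ∷ w) (x≤y ∷ _) h = T-∧⁺ (≤⇒≤ᵇ x≤y) h

weaklyIncr-tail : ∀ x w → T (weaklyIncr (x ∷ w)) → T (weaklyIncr w)
weaklyIncr-tail x []      _ = _
weaklyIncr-tail x (y ∷ w) h = T-∧ʳ (x ≤ᵇ y) h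

weaklyIncr⇒All≥ : ∀ x w → T (weaklyIncr (x ∷ w)) → All (x ≤_) w
weaklyIncr⇒All≥ x []      _ = []
weaklyIncr⇒All≥ x (y ∷ w) h =
  x≤y ∷ All.map (≤-trans x≤y) (weaklyIncr⇒All≥ y w (T-∧ʳ (x ≤ᵇ y) h))
  where
  x≤y : x ≤ y
  x≤y = ≤ᵇ⇒≤ x y (T-∧ˡ (x ≤ᵇ y) h)

weaklyIncr-replicate-++ : ∀ k {v} w → All (v ≤_) w → T (weaklyIncr w) → T (weaklyIncr (replicate k v ++ w))
weaklyIncr-replicate-++ zero    w _   h = h
weaklyIncr-replicate-++ (suc k) w v≤w h =
  weaklyIncr-∷ _ (++⁺ (replicate⁺ k ≤-refl) v≤w) (weaklyIncr-replicate-++ k w v≤w h)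

weaklyIncr-blocks : ∀ bs → T (weaklyIncr (map proj₂ bs)) → T (weaklyIncr (blocks bs))
weaklyIncr-blocks []             _ = _
weaklyIncr-blocks ((k , v) ∷ bs) h =
  weaklyIncr-replicate-++ k (blocks bs)
    (All-blocks bs (map⁻ (weaklyIncr⇒All≥ v (map proj₂ bs) h)))
    (weaklyIncr-blocks bs (weaklyIncr-tail v (map proj₂ bs) h))

hasType-blocks : ∀ ν α bss →
  T (allB (λ x → (1 ≤ᵇ x) ∧ (x ≤ᵇ length ν)) (map proj₂ (concat bss))) →
  (∀ i → 1 ≤ i → i ≤ length ν → multiplicity i (concat bss) ≡ part ν i ∸ part α i) →
  T (hasType ν α (map blocks bss))
hasType-blocks ν α bss letters counts rewrite concat-blocks bss =
  T-∧⁺ (allB⁺ (All-blocks (concat bss) (map⁻ (allB⁻ _ letters))))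
       (allB⁺ {xs = range1 (length ν)} (All.tabulate λ {i} i∈ → let 1≤i , i≤ℓν = ∈-range1⁻ i∈ in
         ≡⇒≡ᵇ _ _ (trans (countEq-blocks i (concat bss)) (counts i 1≤i i≤ℓν))))

take-replicate-++ˡ : ∀ {A : Set} {m k} {v : A} t → m ≤ k → take m (replicate k v ++ t) ≡ replicate m v
take-replicate-++ˡ t z≤n       = refl
take-replicate-++ˡ t (s≤s m≤k) = cong (_ ∷_) (take-replicate-++ˡ t m≤k)

take-replicate-++ʳ : ∀ {A : Set} {m} k {v : A} t → k ≤ m →
                     take m (replicate k v ++ t) ≡ replicate k v ++ take (m ∸ k) t
take-replicate-++ʳ zero    t _         = refl
take-replicate-++ʳ (suc k) t (s≤s k≤m) = cong (_ ∷_) (take-replicate-++ʳ k t k≤m)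

get-≥length : ∀ xs i → length xs ≤ i → get xs i ≡ 0
get-≥length []       i       _         = refl
get-≥length (x ∷ xs) (suc i) (s≤s l≤i) = get-≥length xs i l≤i

countEq-absent : ∀ x w → All (_< x) w → countEq x w ≡ 0
countEq-absent x []      []           = refl
countEq-absent x (y ∷ w) (y<x ∷ w<x) with x ≡ᵇ y in x≡y
... | true  = ⊥-elim (<-irrefl (sym (≡ᵇ⇒≡ x y (subst T (sym x≡y) _))) y<x)
... | false = countEq-absent x w w<x

interpolate : ∀ {s t : Bool} {a b j k} → (T s → T t → ⊥) → j ≤ k →
  a + 0 ≤ b + 0 → a + (if s then k else 0) ≤ b + (if t then k else 0) →
  a + (if s then j else 0) ≤ b + (if t then j else 0)
interpolate {true}  {true}          s→t→⊥ _   _   _   = ⊥-elim (s→t→⊥ _ _)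
interpolate {true}  {false} {a}     _     j≤k _   atK = ≤-trans (+-monoʳ-≤ a j≤k) atK
interpolate {false} {true}  {b = b} _     _   at0 _   = ≤-trans at0 (+-monoʳ-≤ b z≤n)
interpolate {false} {false}         _     _   at0 _   = at0

prefixes-blocks : ∀ {x y} → x ≢ y → ∀ a b bs →
  All (λ c → a + multiplicity x c ≤ b + multiplicity y c) (inits bs) →
  ∀ m → a + countEq x (take m (blocks bs)) ≤ b + countEq y (take m (blocks bs))
prefixes-blocks x≢y a b [] (at0 ∷ []) m rewrite take-[] {A = ℕ} m = at0
prefixes-blocks {x} {y} x≢y a b ((k , v) ∷ bs) (at0 ∷ atK ∷ rest) m =
  [ insideBlock , pastBlock ]′ (≤-total m k)
  where
  δ : ℕ → ℕ → ℕ
  δ j z = if z ≡ᵇ v then j else 0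
  prefix : List ℕ
  prefix = take m (replicate k v ++ blocks bs)
  shift : ∀ z a {n r} → n ≡ δ k z + r → a + δ k z + r ≡ a + n
  shift z a eq = trans (+-assoc a (δ k z) _) (cong (a +_) (sym eq))

  insideBlock : m ≤ k → a + countEq x prefix ≤ b + countEq y prefix
  insideBlock m≤k =
    subst₂ _≤_ (cong (a +_) (count x)) (cong (b +_) (count y)) (interpolate distinct m≤k at0 atK)
    where
    distinct : T (x ≡ᵇ v) → T (y ≡ᵇ v) → ⊥
    distinct x≡v y≡v = x≢y (trans (≡ᵇ⇒≡ x v x≡v) (sym (≡ᵇ⇒≡ y v y≡v)))
    count : ∀ z → δ m z ≡ countEq z prefix
    count z = sym (trans (cong (countEq z) (take-replicate-++ˡ (blocks bs) m≤k)) (countEq-replicate z v m))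

  pastBlock : k ≤ m → a + countEq x prefix ≤ b + countEq y prefix
  pastBlock k≤m = subst₂ _≤_ (shift x a (count x)) (shift y b (count y))
    (prefixes-blocks x≢y (a + δ k x) (b + δ k y) bs
      (All.map (λ {c} → subst₂ _≤_ (sym (shift x a (multiplicity-∷ x k v c)))
                                   (sym (shift y b (multiplicity-∷ y k v c))))
               (map⁻ {xs = inits bs} {f = (k , v) ∷_} (atK ∷ rest)))
      (m ∸ k))
    where
    count : ∀ z → countEq z prefix ≡ δ k z + countEq z (take (m ∸ k) (blocks bs))
    count z = trans (cong (countEq z) (take-replicate-++ʳ k (blocks bs) k≤m)) (countEq-replicate-++ z v k _)

latticeUpTo-intro : ∀ {B α w} →
  (∀ m i → 1 ≤ i → countEq (suc i) (take m w) + part α (suc i) ≤ countEq i (take m w) + part α i) →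
  T (latticeUpTo B α w)
latticeUpTo-intro {B} {α} {w} dominates = allB⁺ {xs = prefixes w} (All.tabulate atPrefix)
  where
  atPrefix : ∀ {u} → u ∈ prefixes w →
             T (allB (λ i → (countEq (suc i) u + part α (suc i)) ≤ᵇ (countEq i u + part α i)) (range1 B))
  atPrefix u∈ with ∈-map⁻ (λ m → take m w) {xs = upTo (suc (length w))} u∈
  ... | m , _ , refl =
    allB⁺ {xs = range1 B} (All.tabulate λ {i} i∈ → ≤⇒≤ᵇ (dominates m i (proj₁ (∈-range1⁻ i∈))))

-- The α-offsets come first so that for concrete α the bounds normalise (`0 + n` reduces).
isαLattice-blocks : ∀ d α bs → length α ≤ d → T (allB (_≤ᵇ d) (map proj₂ bs)) →
  (∀ i → 1 ≤ i → i < d →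
     All (λ c → part α (suc i) + multiplicity (suc i) c ≤ part α i + multiplicity i c) (inits bs)) →
  T (isαLattice α (blocks bs))
isαLattice-blocks d α bs ℓα≤d letters≤d boundaries =
  latticeUpTo-intro {B = maxL (blocks bs) + length α + 1} {α} dominates
  where
  letters : All (_≤ d) (blocks bs)
  letters = All-blocks bs (map⁻ (All.map (λ {x} → ≤ᵇ⇒≤ x d) (allB⁻ _ letters≤d)))
  dominates : ∀ m i → 1 ≤ i →
    countEq (suc i) (take m (blocks bs)) + part α (suc i) ≤ countEq i (take m (blocks bs)) + part α i
  dominates m i 1≤i with i <? d
  ... | yes i<d = subst₂ _≤_ (+-comm (part α (suc i)) _) (+-comm (part α i) _)
                    (prefixes-blocks 1+n≢n (part α (suc i)) (part α i) bs (boundaries i 1≤i i<d) m)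
  ... | no i≮d
    rewrite countEq-absent (suc i) (take m (blocks bs))
              (take⁺ m (All.map (λ x≤d → s≤s (≤-trans x≤d (≮⇒≥ i≮d))) letters))
          | get-≥length α i (≤-trans ℓα≤d (≮⇒≥ i≮d)) = z≤n

kron-pos-blocks : ∀ l₁ l₂ α ν bs₁ bs₂ →
  length (blocks bs₁) ≡ l₁ ∸ part α 1 → length (blocks bs₂) ≡ l₂ ∸ part α 2 →
  T (weaklyIncr (map proj₂ bs₁)) → T (weaklyIncr (map proj₂ bs₂)) →
  (∀ j → part α 1 < j → j ≤ l₂ → get (blocks bs₁) (j ∸ part α 1 ∸ 1) < get (blocks bs₂) (j ∸ part α 2 ∸ 1)) →
  T (allB (λ x → (1 ≤ᵇ x) ∧ (x ≤ᵇ length ν)) (map proj₂ (bs₁ ++ bs₂ ++ []))) →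
  (∀ i → 1 ≤ i → i ≤ length ν → multiplicity i (bs₁ ++ bs₂ ++ []) ≡ part ν i ∸ part α i) →
  length α ≤ length ν →
  T (allB (_≤ᵇ length ν) (map proj₂ (concatMap reverse (bs₁ ∷ bs₂ ∷ [])))) →
  (∀ i → 1 ≤ i → i < length ν →
     All (λ c → part α (suc i) + multiplicity (suc i) c ≤ part α i + multiplicity i c)
         (inits (concatMap reverse (bs₁ ∷ bs₂ ∷ [])))) →
  T (kronCond α (blocks bs₁ ∷ blocks bs₂ ∷ [])) →
  1 ≤ kron (l₁ ∷ l₂ ∷ []) α ν
kron-pos-blocks l₁ l₂ α ν bs₁ bs₂ len₁ len₂ incr₁ incr₂ columns letters counts ℓα≤ℓν wordLetters boundaries cond =
  kron-pos-twoRow l₁ l₂ α ν (blocks bs₁) (blocks bs₂) len₁ len₂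
    (weaklyIncr-blocks bs₁ incr₁) (weaklyIncr-blocks bs₂ incr₂) columns
    (hasType-blocks ν α (bs₁ ∷ bs₂ ∷ []) letters counts)
    (subst (T ∘ isαLattice α) (sym (revReadingWord-blocks (bs₁ ∷ bs₂ ∷ [])))
      (isαLattice-blocks (length ν) α _ ℓα≤ℓν wordLetters boundaries))
    cond

get-replicate-++ : ∀ {i k} {v : ℕ} t → i < k → get (replicate k v ++ t) i ≡ v
get-replicate-++ {zero}  {suc k} t _         = refl
get-replicate-++ {suc i} {suc k} t (s≤s i<k) = get-replicate-++ t i<k

get-≤ : ∀ {v} xs i → All (_≤ v) xs → get xs i ≤ v
get-≤ []       i       _            = z≤n
get-≤ (x ∷ xs) zero    (x≤v ∷ _)    = x≤v
get-≤ (x ∷ xs) (suc i) (_ ∷ xs≤v)   = get-≤ xs i xs≤v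

≤-get : ∀ {v i} ys → All (v ≤_) ys → i < length ys → v ≤ get ys i
≤-get {i = zero}  (y ∷ ys) (v≤y ∷ _)  _        = v≤y
≤-get {i = suc i} (y ∷ ys) (_ ∷ v≤ys) (s≤s i<) = ≤-get ys v≤ys i<

≤-get-++ʳ : ∀ {v i} xs ys → All (v ≤_) ys → length xs ≤ i → i < length (xs ++ ys) → v ≤ get (xs ++ ys) i
≤-get-++ʳ []       ys v≤ys _         i<       = ≤-get ys v≤ys i<
≤-get-++ʳ (x ∷ xs) ys v≤ys (s≤s l≤i) (s≤s i<) = ≤-get-++ʳ xs ys v≤ys l≤i i<

kron-α2-pos : ∀ p q b → q ≤ 2 → b ≤ p → 1 ≤ kron (4 + p ∷ 1 + q + b ∷ []) (2 ∷ []) (2 + q + p ∷ 2 + b ∷ 1 ∷ [])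
kron-α2-pos p q b q≤2 b≤p =
  kron-pos-blocks (4 + p) (1 + q + b) (2 ∷ []) (2 + q + p ∷ 2 + b ∷ 1 ∷ []) row₁ row₂
    (trans (length-blocks row₁) (+-comm p 2)) len₂ _ _ columns _ counts (s≤s z≤n) _ boundaries
    (T-∨ʳ (countEq 1 (blocks row₂) ≡ᵇ 2) twoTwosInRow₁)
  where
  row₁ row₂ : List (ℕ × ℕ)
  row₁ = (p , 1) ∷ (2 , 2) ∷ []
  row₂ = (q , 1) ∷ (b , 2) ∷ (1 , 3) ∷ []

  len₂ : length (blocks row₂) ≡ 1 + q + b
  len₂ = trans (length-blocks row₂) (trans (cong (q +_) (+-comm b 1)) (+-suc q b))

  in-row₂ : ∀ {i} → i ≤ q + b → i < length (blocks row₂)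
  in-row₂ {i} i≤q+b = subst (i <_) (sym len₂) (s≤s i≤q+b)

  row₁≤2 : ∀ i → get (blocks row₁) i ≤ 2
  row₁≤2 i = get-≤ (blocks row₁) i (++⁺ (replicate⁺ p (s≤s z≤n)) (≤-refl ∷ ≤-refl ∷ []))

  row₂≥2 : ∀ {i} → q ≤ i → i ≤ q + b → 2 ≤ get (blocks row₂) i
  row₂≥2 {i} q≤i i≤q+b =
    ≤-get-++ʳ (replicate q 1) _ (++⁺ (replicate⁺ b ≤-refl) (s≤s (s≤s z≤n) ∷ []))
      (subst (_≤ i) (sym (length-replicate q)) q≤i) (in-row₂ i≤q+b)

  row₂≥3 : ∀ {i} → q + b ≤ i → i ≤ q + b → 3 ≤ get (blocks row₂) i
  row₂≥3 {i} q+b≤i i≤q+b =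
    subst (λ r → 3 ≤ get r i) (++-assoc (replicate q 1) (replicate b 2) (3 ∷ []))
      (≤-get-++ʳ (replicate q 1 ++ replicate b 2) (3 ∷ []) (≤-refl ∷ [])
        (subst (_≤ i) (sym (trans (length-++ (replicate q 1)) (cong₂ _+_ (length-replicate q) (length-replicate b))))
               q+b≤i)
        (subst (λ r → i < length r) (sym (++-assoc (replicate q 1) (replicate b 2) (3 ∷ []))) (in-row₂ i≤q+b)))

  columns : ∀ j → 2 < j → j ≤ 1 + q + b → get (blocks row₁) (j ∸ 2 ∸ 1) < get (blocks row₂) (j ∸ 0 ∸ 1)
  columns (suc (suc (suc m))) (s≤s (s≤s (s≤s _))) (s≤s 2+m≤q+b) with m <? p
  ... | yes m<p = subst (_< get (blocks row₂) (2 + m)) (sym (get-replicate-++ (2 ∷ 2 ∷ []) m<p))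
                    (row₂≥2 (≤-trans q≤2 (m≤m+n 2 m)) 2+m≤q+b)
  ... | no m≮p  = ≤-trans (s≤s (row₁≤2 m)) (row₂≥3 (+-mono-≤ q≤2 (≤-trans b≤p (≮⇒≥ m≮p))) 2+m≤q+b)

  counts : ∀ i → 1 ≤ i → i ≤ 3 →
           multiplicity i (row₁ ++ row₂ ++ []) ≡ part (2 + q + p ∷ 2 + b ∷ 1 ∷ []) i ∸ part (2 ∷ []) i
  counts 1 _ _ = refl
  counts 2 _ _ = +-comm b 2
  counts 3 _ _ = refl
  counts (suc (suc (suc (suc _)))) _ (s≤s (s≤s (s≤s ())))

  boundaries : ∀ i → 1 ≤ i → i < 3 →
    All (λ c → part (2 ∷ []) (suc i) + multiplicity (suc i) c ≤ part (2 ∷ []) i + multiplicity i c)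
        (inits ((2 , 2) ∷ (p , 1) ∷ (1 , 3) ∷ (b , 2) ∷ (q , 1) ∷ []))
  boundaries 1 _ _ =
    z≤n ∷ ≤-refl ∷ m≤m+n 2 p ∷ m≤m+n 2 p ∷ twos≤ones b≤p ∷ twos≤ones (≤-trans b≤p (m≤n+m p q)) ∷ []
    where
    twos≤ones : ∀ {n} → b ≤ n → b + 2 ≤ 2 + n
    twos≤ones {n} b≤n = subst (_≤ 2 + n) (+-comm 2 b) (+-monoʳ-≤ 2 b≤n)
  boundaries 2 _ _ = z≤n ∷ z≤n ∷ z≤n ∷ s≤s z≤n ∷ one≤ ∷ one≤ ∷ []
    where
    one≤ : 1 ≤ b + 2
    one≤ = ≤-trans (s≤s z≤n) (m≤n+m 2 b)
  boundaries (suc (suc (suc _))) _ (s≤s (s≤s (s≤s ())))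

  twoTwosInRow₁ : T (countEq 2 (blocks row₁) ≡ᵇ 2)
  twoTwosInRow₁ = subst (λ n → T (n ≡ᵇ 2)) (sym (countEq-blocks 2 row₁)) _

kron-α11-pos-3InRow1 : ∀ p m → m ≤ p → 1 ≤ kron (2 + p ∷ 1 + m ∷ []) (1 ∷ 1 ∷ []) (1 + p ∷ 1 + m ∷ 1 ∷ [])
kron-α11-pos-3InRow1 p m m≤p =
  kron-pos-blocks (2 + p) (1 + m) (1 ∷ 1 ∷ []) (1 + p ∷ 1 + m ∷ 1 ∷ []) row₁ row₂
    (trans (length-blocks row₁) (+-comm p 1)) (trans (length-blocks row₂) (+-identityʳ m))
    _ _ columns _ counts (s≤s (s≤s z≤n)) _ boundaries _
  where
  row₁ row₂ : List (ℕ × ℕ)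
  row₁ = (p , 1) ∷ (1 , 3) ∷ []
  row₂ = (m , 2) ∷ []

  columns : ∀ j → 1 < j → j ≤ 1 + m → get (blocks row₁) (j ∸ 1 ∸ 1) < get (blocks row₂) (j ∸ 1 ∸ 1)
  columns (suc (suc i)) (s≤s (s≤s _)) (s≤s i<m) =
    subst₂ _<_ (sym (get-replicate-++ (3 ∷ []) (≤-trans i<m m≤p))) (sym (get-replicate-++ [] i<m)) (s≤s (s≤s z≤n))

  counts : ∀ i → 1 ≤ i → i ≤ 3 →
           multiplicity i (row₁ ++ row₂ ++ []) ≡ part (1 + p ∷ 1 + m ∷ 1 ∷ []) i ∸ part (1 ∷ 1 ∷ []) i
  counts 1 _ _ = refl
  counts 2 _ _ = refl
  counts 3 _ _ = refl
  counts (suc (suc (suc (suc _)))) _ (s≤s (s≤s (s≤s ())))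

  boundaries : ∀ i → 1 ≤ i → i < 3 →
    All (λ c → part (1 ∷ 1 ∷ []) (suc i) + multiplicity (suc i) c ≤ part (1 ∷ 1 ∷ []) i + multiplicity i c)
        (inits ((1 , 3) ∷ (p , 1) ∷ (m , 2) ∷ []))
  boundaries 1 _ _ = ≤-refl ∷ ≤-refl ∷ s≤s z≤n ∷ s≤s m≤p ∷ []
  boundaries 2 _ _ = z≤n ∷ ≤-refl ∷ ≤-refl ∷ s≤s z≤n ∷ []
  boundaries (suc (suc (suc _))) _ (s≤s (s≤s (s≤s ())))

kron-α11-pos-3InRow2 : ∀ p m → m < p → 1 ≤ kron (1 + p ∷ 2 + m ∷ []) (1 ∷ 1 ∷ []) (1 + p ∷ 1 + m ∷ 1 ∷ [])
kron-α11-pos-3InRow2 p m m<p =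
  kron-pos-blocks (1 + p) (2 + m) (1 ∷ 1 ∷ []) (1 + p ∷ 1 + m ∷ 1 ∷ []) row₁ row₂
    (trans (length-blocks row₁) (+-identityʳ p)) len₂
    _ _ columns _ counts (s≤s (s≤s z≤n)) _ boundaries _
  where
  row₁ row₂ : List (ℕ × ℕ)
  row₁ = (p , 1) ∷ []
  row₂ = (m , 2) ∷ (1 , 3) ∷ []

  len₂ : length (blocks row₂) ≡ 1 + m
  len₂ = trans (length-blocks row₂) (+-comm m 1)

  columns : ∀ j → 1 < j → j ≤ 2 + m → get (blocks row₁) (j ∸ 1 ∸ 1) < get (blocks row₂) (j ∸ 1 ∸ 1)
  columns (suc (suc i)) (s≤s (s≤s _)) (s≤s (s≤s i≤m)) =
    subst (_< get (blocks row₂) i) (sym (get-replicate-++ [] (≤-trans (s≤s i≤m) m<p)))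
      (≤-get (blocks row₂) (++⁺ (replicate⁺ m ≤-refl) (s≤s (s≤s z≤n) ∷ [])) (subst (i <_) (sym len₂) (s≤s i≤m)))

  counts : ∀ i → 1 ≤ i → i ≤ 3 →
           multiplicity i (row₁ ++ row₂ ++ []) ≡ part (1 + p ∷ 1 + m ∷ 1 ∷ []) i ∸ part (1 ∷ 1 ∷ []) i
  counts 1 _ _ = refl
  counts 2 _ _ = refl
  counts 3 _ _ = refl
  counts (suc (suc (suc (suc _)))) _ (s≤s (s≤s (s≤s ())))

  boundaries : ∀ i → 1 ≤ i → i < 3 →
    All (λ c → part (1 ∷ 1 ∷ []) (suc i) + multiplicity (suc i) c ≤ part (1 ∷ 1 ∷ []) i + multiplicity i c)
        (inits ((p , 1) ∷ (1 , 3) ∷ (m , 2) ∷ []))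
  boundaries 1 _ _ = ≤-refl ∷ s≤s z≤n ∷ s≤s z≤n ∷ s≤s (<⇒≤ m<p) ∷ []
  boundaries 2 _ _ = z≤n ∷ z≤n ∷ ≤-refl ∷ s≤s z≤n ∷ []
  boundaries (suc (suc (suc _))) _ (s≤s (s≤s (s≤s ())))

kron-pos-l₁>l₂+1 : ∀ b l₁ → 2 + b + 1 < l₁ →
    (1 ≤ kron (l₁ ∷ 2 + b ∷ []) (2 ∷ []) (l₁ ∸ 1 ∷ 2 + b ∷ 1 ∷ []))
  × (1 ≤ kron (l₁ ∷ 2 + b ∷ []) (1 ∷ 1 ∷ []) (l₁ ∸ 1 ∷ 2 + b ∷ 1 ∷ []))
kron-pos-l₁>l₂+1 b l₁ 3+b<l₁ with m≤n⇒∃[o]m+o≡n (subst (_≤ l₁) (cong (3 +_) (+-comm b 1)) 3+b<l₁)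
... | c , refl =
  kron-α2-pos (b + c) 1 b (s≤s z≤n) (m≤m+n b c) ,
  kron-α11-pos-3InRow1 (2 + b + c) (1 + b) (s≤s (≤-trans (m≤m+n b c) (n≤1+n (b + c))))

kron-pos-l₁≡l₂+1 : ∀ n l₁ b → 6 ≤ n → l₁ + (2 + b) ≡ n → l₁ ≡ 2 + b + 1 →
    (1 ≤ kron (l₁ ∷ 2 + b ∷ []) (2 ∷ []) (l₁ ∷ 2 + b ∸ 1 ∷ 1 ∷ []))
  × (1 ≤ kron (l₁ ∷ 2 + b ∷ []) (1 ∷ 1 ∷ []) (l₁ ∷ 2 + b ∸ 1 ∷ 1 ∷ []))
kron-pos-l₁≡l₂+1 _ _ zero    (s≤s (s≤s (s≤s (s≤s (s≤s ()))))) refl refl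
kron-pos-l₁≡l₂+1 _ l₁ (suc b) _ _ l₁≡ with trans l₁≡ (cong (3 +_) (+-comm b 1))
... | refl =
  kron-α2-pos b 2 b ≤-refl ≤-refl ,
  kron-α11-pos-3InRow2 (3 + b) (1 + b) (s≤s (s≤s (n≤1+n b)))

lemma4p4 : (n l₁ l₂ : ℕ) → 6 ≤ n → l₁ + l₂ ≡ n → l₂ < l₁ → 1 < l₂ →
    (l₂ + 1 < l₁ →
       (1 ≤ kron (l₁ ∷ l₂ ∷ []) (2 ∷ []) (l₁ ∸ 1 ∷ l₂ ∷ 1 ∷ []))
       × (1 ≤ kron (l₁ ∷ l₂ ∷ []) (1 ∷ 1 ∷ []) (l₁ ∸ 1 ∷ l₂ ∷ 1 ∷ [])))
    × (l₁ ≡ l₂ + 1 →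
       (1 ≤ kron (l₁ ∷ l₂ ∷ []) (2 ∷ []) (l₁ ∷ l₂ ∸ 1 ∷ 1 ∷ []))
       × (1 ≤ kron (l₁ ∷ l₂ ∷ []) (1 ∷ 1 ∷ []) (l₁ ∷ l₂ ∸ 1 ∷ 1 ∷ [])))
lemma4p4 _ _  zero          _   _       _ ()
lemma4p4 _ _  (suc zero)    _   _       _ (s≤s ())
lemma4p4 n l₁ (suc (suc b)) 6≤n l₁+l₂≡n _ _ = kron-pos-l₁>l₂+1 b l₁ , kron-pos-l₁≡l₂+1 n l₁ b 6≤n l₁+l₂≡n
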